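{- Let $k,n>0$ and let $\alpha<\omega^{\omega^\omega}$ be an ordinal in Cantor normal form that is $k$-lean. If $\alpha'\in\partial_n\alpha$, then $\alpha'$ is $kn$-lean.
   Context: An ordinal $\alpha<\varepsilon_0$ in Cantor normal form is $k$-lean if, written in strict form $\alpha=\omega^{\beta_1}\cdot c_1+\cdots+\omega^{\beta_m}\cdot c_m$ with $\beta_1>\cdots>\beta_m$ and coefficients $c_i>0$, all $c_i\leq k$ and all $\beta_i$ are (inductively) $k$-lean. $\oplus,\otimes$ are natural sum and product. For $n>0$: $D_n(\omega^{\omega^p})=n-1$ if $p=0$ and $\omega^{\omega^{p-1}\cdot(n-1)}\cdot(n-1)$ if $p>0$; $D_n(\omega^{\omega^{p_1}+\cdots+\omega^{p_k}})=\bigoplus_{j=1}^k\bigl(D_n(\omega^{\omega^{p_j}})\otimes\bigotimes_{\ell\neq j}\omega^{\omega^{p_\ell}}\bigr)$; $\partial_n(\sum_{i=1}^m\omega^{\beta_i})=\{D_n(\omega^{\beta_i})\oplus\bigoplus_{\ell\neq i}\omega^{\beta_\ell}:1\leq i\leq m\}$ (CNF with $\beta_1\geq\cdots\geq\beta_m$). -}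

module Defs where

open import Data.Nat using (ℕ; zero; suc; _≤_; _∸_)
open import Data.List using (List; []; _∷_; map; foldr; replicate; concatMap)
open import Data.List.Relation.Unary.All using (All)
open import Data.List.Relation.Unary.Linked using (Linked)
open import Data.Product using (_×_; _,_; proj₁; proj₂)
open import Relation.Binary.PropositionalEquality using (_≡_; _≢_)

-- Ordinals below ε₀ as Cantor-normal-form trees:
-- cnf [β₁, …, βₘ] denotes ω^β₁ + ⋯ + ω^βₘ (exponents listed with
-- repetition, i.e. coefficients are multiplicities).

data Ord : Set where
  cnf : List Ord → Ord

data Cmp : Set where
  lt eq gt : Cmp

mutual
  compareₒ : Ord → Ord → Cmp
  compareₒ (cnf xs) (cnf ys) = compareL xs ys

  compareL : List Ord → List Ord → Cmp
  compareL [] [] = eq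
  compareL [] (_ ∷ _) = lt
  compareL (_ ∷ _) [] = gt
  compareL (x ∷ xs) (y ∷ ys) with compareₒ x y
  ... | lt = lt
  ... | gt = gt
  ... | eq = compareL xs ys

_<ₒ_ : Ord → Ord → Set
a <ₒ b = compareₒ a b ≡ lt

_≤ₒ_ : Ord → Ord → Set
a ≤ₒ b = compareₒ a b ≢ gt

data IsCNF : Ord → Set where
  isCNF : ∀ {xs} → Linked (λ a b → b ≤ₒ a) xs → All IsCNF xs → IsCNF (cnf xs)

𝟎 : Ord
𝟎 = cnf []

𝟏 : Ord
𝟏 = cnf (𝟎 ∷ [])

fin : ℕ → Ord
fin m = cnf (replicate m 𝟎)

ω^ : Ord → Ord
ω^ β = cnf (β ∷ [])

ω^ω^ω : Ord
ω^ω^ω = ω^ (ω^ (ω^ 𝟏))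

merge : List Ord → List Ord → List Ord
merge [] ys = ys
merge (x ∷ xs) ys = mergeAux ys
  where
  pick : Cmp → List Ord → List Ord → List Ord
  pick lt a b = a
  pick eq a b = b
  pick gt a b = b
  mergeAux : List Ord → List Ord
  mergeAux [] = x ∷ xs
  mergeAux (y ∷ ys') = pick (compareₒ x y) (y ∷ mergeAux ys') (x ∷ merge xs (y ∷ ys'))

_⊕_ : Ord → Ord → Ord
cnf xs ⊕ cnf ys = cnf (merge xs ys)

-- (Σ ω^xᵢ) ⊗ (Σ ω^yⱼ) = ⨁_{i,j} ω^(xᵢ ⊕ yⱼ)
_⊗_ : Ord → Ord → Ord
cnf xs ⊗ cnf ys = foldr _⊕_ 𝟎 (concatMap (λ x → map (λ y → ω^ (x ⊕ y)) ys) xs)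

⨁ : List Ord → Ord
⨁ = foldr _⊕_ 𝟎

⨂ : List Ord → Ord
⨂ = foldr _⊗_ 𝟏

-- strict form: group consecutive equal exponents, with multiplicities
group : List Ord → List (Ord × ℕ)
group [] = []
group (x ∷ xs) with group xs
... | [] = (x , 1) ∷ []
... | (y , c) ∷ r with compareₒ x y
...   | eq = (y , suc c) ∷ r
...   | lt = (x , 1) ∷ (y , c) ∷ r
...   | gt = (x , 1) ∷ (y , c) ∷ r

data Lean (k : ℕ) : Ord → Set where
  lean : ∀ {xs} →
         All (λ p → proj₂ p ≤ k × Lean k (proj₁ p)) (group xs) →
         Lean k (cnf xs)

picks : {A : Set} → List A → List (A × List A)
picks [] = []
picks (x ∷ xs) = (x , xs) ∷ map (λ p → proj₁ p , x ∷ proj₂ p) (picks xs)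

-- predecessor of a finite ordinal (removes a trailing ω^0 term);
-- only used on finite ordinals
dropLast : List Ord → List Ord
dropLast [] = []
dropLast (x ∷ []) = []
dropLast (x ∷ y ∷ ys) = x ∷ dropLast (y ∷ ys)

predₒ : Ord → Ord
predₒ (cnf xs) = cnf (dropLast xs)

-- Dω1 n p = D_n(ω^(ω^p))
Dω1 : ℕ → Ord → Ord
Dω1 n (cnf []) = fin (n ∸ 1)
Dω1 n (cnf (x ∷ xs)) =
  cnf (replicate (n ∸ 1) (cnf (replicate (n ∸ 1) (predₒ (cnf (x ∷ xs))))))

-- Dω n β = D_n(ω^β) for β = ω^p₁ + ⋯ + ω^pₖ, i.e. β = cnf [p₁,…,pₖ]:
-- ⨁ⱼ ( D_n(ω^(ω^pⱼ)) ⊗ ⨂_{ℓ≠j} ω^(ω^pℓ) )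
Dω : ℕ → Ord → Ord
Dω n (cnf ps) = ⨁ (map (λ q → Dω1 n (proj₁ q) ⊗ ⨂ (map (λ p → ω^ (ω^ p)) (proj₂ q))) (picks ps))

∂ : ℕ → Ord → List Ord
∂ n (cnf βs) = map (λ p → Dω n (proj₁ p) ⊕ ⨁ (map ω^ (proj₂ p))) (picks βs)

module Submission where

-- Leanness of α = ω^β₁ + ⋯ + ω^βₘ is a multiset condition on its exponent
-- list: every exponent is lean and no exponent occurs more than k times.
--
-- For α' = D_n(ω^β) ⊕ ⨁_{ℓ≠i} ω^βℓ with β = ω^p₁ + ⋯ + ω^pₖ, the summand
-- D_n(ω^β) is ⨁ⱼ ω^{eⱼ}·(n−1) where eⱼ = dExp(pⱼ) ⊕ ⨁_{ℓ≠j} ω^pℓ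
-- (mult-Dω).  The exponent eⱼ determines pⱼ (termExp-injective), because
-- dExp(pⱼ) only involves the predecessor of pⱼ; hence every exponent of
-- D_n(ω^β) occurs at most (n−1)·k times, and it is itself (n−1+k)-lean
-- (termExp-lean).  Adding the at most k copies coming from the other
-- terms of α gives the bound (n−1)k + k = kn.

open import Defs
open import Data.Nat using (ℕ; zero; suc; _+_; _*_; _∸_; _≤_; _<_; _>_; z≤n; s≤s; NonZero; >-nonZero)
open import Data.Nat.Properties
  using (module ≤-Reasoning; ≤-refl; ≤-reflexive; ≤-trans; n≤1+n; 1+n≰n; m≤m+n; m≤n+m; m≤m*n; +-mono-≤; +-monoˡ-≤; *-monoʳ-≤;
         +-comm; +-identityʳ; *-comm; *-suc; *-zeroʳ; *-identityʳ; *-distribˡ-+; +-assoc)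
open import Data.Nat.ListAction using (sum)
open import Data.List using (List; []; _∷_; map; replicate; length)
open import Data.List.Properties using (map-∘)
open import Data.List.Membership.Propositional using (_∈_)
open import Data.List.Membership.Propositional.Properties using (∈-map⁻)
open import Data.List.Relation.Unary.All as All using (All; []; _∷_)
open import Data.List.Relation.Unary.Any using (here; there)
open import Data.List.Relation.Unary.AllPairs using (_∷_)
open import Data.List.Relation.Unary.Linked using (Linked; []; [-]; _∷_)
open import Data.List.Relation.Unary.Linked.Properties using (Linked⇒AllPairs)
open import Data.Product using (∃; _×_; _,_; proj₁; proj₂)
open import Data.Sum using (_⊎_; inj₁; inj₂)
open import Data.Empty using (⊥-elim)
open import Function using (case_of_)
open import Relation.Nullary using (yes; no)
open import Relation.Binary.Definitions using (DecidableEquality)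
open import Relation.Binary.PropositionalEquality

reverseCmp : Cmp → Cmp
reverseCmp lt = gt
reverseCmp eq = eq
reverseCmp gt = lt

mutual
  compare-swap : ∀ a b → compareₒ b a ≡ reverseCmp (compareₒ a b)
  compare-swap (cnf xs) (cnf ys) = compareL-swap xs ys

  compareL-swap : ∀ xs ys → compareL ys xs ≡ reverseCmp (compareL xs ys)
  compareL-swap [] [] = refl
  compareL-swap [] (y ∷ ys) = refl
  compareL-swap (x ∷ xs) [] = refl
  compareL-swap (x ∷ xs) (y ∷ ys) with compareₒ x y | compare-swap x y
  ... | lt | yx rewrite yx = refl
  ... | gt | yx rewrite yx = refl
  ... | eq | yx rewrite yx = compareL-swap xs ys

mutual
  compare-refl : ∀ a → compareₒ a a ≡ eq
  compare-refl (cnf xs) = compareL-refl xs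

  compareL-refl : ∀ xs → compareL xs xs ≡ eq
  compareL-refl [] = refl
  compareL-refl (x ∷ xs) rewrite compare-refl x = compareL-refl xs

mutual
  compare-eq : ∀ a b → compareₒ a b ≡ eq → a ≡ b
  compare-eq (cnf xs) (cnf ys) h = cong cnf (compareL-eq xs ys h)

  compareL-eq : ∀ xs ys → compareL xs ys ≡ eq → xs ≡ ys
  compareL-eq [] [] h = refl
  compareL-eq (x ∷ xs) (y ∷ ys) h with compareₒ x y in xy
  ... | eq = cong₂ _∷_ (compare-eq x y xy) (compareL-eq xs ys h)

mutual
  <ₒ-trans : ∀ a b c → a <ₒ b → b <ₒ c → a <ₒ c
  <ₒ-trans (cnf xs) (cnf ys) (cnf zs) = <L-trans xs ys zs

  <L-trans : ∀ xs ys zs → compareL xs ys ≡ lt → compareL ys zs ≡ lt → compareL xs zs ≡ lt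
  <L-trans [] (y ∷ ys) (z ∷ zs) _ _ = refl
  <L-trans (x ∷ xs) (y ∷ ys) (z ∷ zs) h₁ h₂ with compareₒ x y in xy | compareₒ y z in yz
  ... | lt | lt rewrite <ₒ-trans x y z xy yz = refl
  ... | lt | eq rewrite sym (compare-eq y z yz) | xy = refl
  ... | eq | lt rewrite compare-eq x y xy | yz = refl
  ... | eq | eq rewrite compare-eq x y xy | compare-eq y z yz | compare-refl z = <L-trans xs ys zs h₁ h₂

-- Kept opaque so that multiplicities never unfold into comparisons.
opaque
  _≟ₒ_ : DecidableEquality Ord
  a ≟ₒ b with compareₒ a b in ab
  ... | eq = yes (compare-eq a b ab)
  ... | lt = no λ { refl → case trans (sym ab) (compare-refl a) of λ () }
  ... | gt = no λ { refl → case trans (sym ab) (compare-refl a) of λ () }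

<ₒ⇒≢ : ∀ a b → a <ₒ b → a ≢ b
<ₒ⇒≢ a .a a<a refl = case trans (sym a<a) (compare-refl a) of λ ()

<ₒ⇒≤ₒ : ∀ a b → a <ₒ b → a ≤ₒ b
<ₒ⇒≤ₒ a b a<b a>b = case trans (sym a<b) a>b of λ ()

>ₒ⇒<ₒ : ∀ a b → compareₒ a b ≡ gt → b <ₒ a
>ₒ⇒<ₒ a b a>b = trans (compare-swap a b) (cong reverseCmp a>b)

≤ₒ⇒<ₒ⊎≡ : ∀ a b → a ≤ₒ b → a <ₒ b ⊎ a ≡ b
≤ₒ⇒<ₒ⊎≡ a b a≤b with compareₒ a b in ab
... | lt = inj₁ refl
... | eq = inj₂ (compare-eq a b ab)
... | gt = ⊥-elim (a≤b refl)

≤ₒ-<ₒ-trans : ∀ a b c → a ≤ₒ b → b <ₒ c → a <ₒ c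
≤ₒ-<ₒ-trans a b c a≤b b<c with ≤ₒ⇒<ₒ⊎≡ a b a≤b
... | inj₁ a<b = <ₒ-trans a b c a<b b<c
... | inj₂ refl = b<c

≤ₒ-trans : ∀ a b c → a ≤ₒ b → b ≤ₒ c → a ≤ₒ c
≤ₒ-trans a b c a≤b b≤c with ≤ₒ⇒<ₒ⊎≡ b c b≤c
... | inj₁ b<c = <ₒ⇒≤ₒ a c (≤ₒ-<ₒ-trans a b c a≤b b<c)
... | inj₂ refl = a≤b

Sorted : List Ord → Set
Sorted = Linked (λ a b → b ≤ₒ a)

sorted-tail : ∀ {x xs} → Sorted (x ∷ xs) → Sorted xs
sorted-tail [-] = []
sorted-tail (_ ∷ s) = s

below-head : ∀ {x xs} → Sorted (x ∷ xs) → All (_≤ₒ x) xs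
below-head s with Linked⇒AllPairs (λ {a} {b} {c} b≤a c≤b → ≤ₒ-trans c b a c≤b b≤a) s
... | below ∷ _ = below

∈-replicate⁻ : ∀ {A : Set} {x y : A} m → x ∈ replicate m y → x ≡ y
∈-replicate⁻ (suc m) (here x≡y) = x≡y
∈-replicate⁻ (suc m) (there x∈) = ∈-replicate⁻ m x∈

+-pos : ∀ a b → 0 < a + b → 0 < a ⊎ 0 < b
+-pos zero b h = inj₂ h
+-pos (suc a) b h = inj₁ (s≤s z≤n)

*-pos⁻ʳ : ∀ a b → 0 < a * b → 0 < b
*-pos⁻ʳ a zero h = subst (0 <_) (*-zeroʳ a) h
*-pos⁻ʳ a (suc b) _ = s≤s z≤n

module _ {C : Set} where

  sum-pos : ∀ (f : C → ℕ) qs → 0 < sum (map f qs) → ∃ λ q → q ∈ qs × 0 < f q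
  sum-pos f (q ∷ qs) h with +-pos (f q) (sum (map f qs)) h
  ... | inj₁ fq>0 = q , here refl , fq>0
  ... | inj₂ rest>0 with sum-pos f qs rest>0
  ...   | q' , q'∈ , fq'>0 = q' , there q'∈ , fq'>0

  sum-mono : ∀ (f g : C → ℕ) qs → (∀ q → q ∈ qs → f q ≤ g q) → sum (map f qs) ≤ sum (map g qs)
  sum-mono f g [] _ = z≤n
  sum-mono f g (q ∷ qs) f≤g = +-mono-≤ (f≤g q (here refl)) (sum-mono f g qs (λ q' q'∈ → f≤g q' (there q'∈)))

  sum-*ˡ : ∀ a (f : C → ℕ) qs → sum (map (λ q → a * f q) qs) ≡ a * sum (map f qs)
  sum-*ˡ a f [] = sym (*-zeroʳ a)
  sum-*ˡ a f (q ∷ qs) = begin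
    a * f q + sum (map (λ q → a * f q) qs) ≡⟨ cong (a * f q +_) (sum-*ˡ a f qs) ⟩
    a * f q + a * sum (map f qs)           ≡⟨ *-distribˡ-+ a (f q) (sum (map f qs)) ⟨
    a * (f q + sum (map f qs))             ∎
    where open ≡-Reasoning

module Multiplicity {A : Set} (_≟_ : DecidableEquality A) where

  δ : A → A → ℕ
  δ x y with x ≟ y
  ... | yes _ = 1
  ... | no _ = 0

  δ-refl : ∀ x → δ x x ≡ 1
  δ-refl x with x ≟ x
  ... | yes _ = refl
  ... | no x≢x = ⊥-elim (x≢x refl)

  δ-≢ : ∀ {x y} → x ≢ y → δ x y ≡ 0
  δ-≢ {x} {y} x≢y with x ≟ y
  ... | yes x≡y = ⊥-elim (x≢y x≡y)
  ... | no _ = refl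

  δ-pos : ∀ x y → 0 < δ x y → x ≡ y
  δ-pos x y h with x ≟ y
  ... | yes x≡y = x≡y

  δ-cases : ∀ x y → x ≡ y ⊎ δ x y ≡ 0
  δ-cases x y with x ≟ y
  ... | yes x≡y = inj₁ x≡y
  ... | no _ = inj₂ refl

  δ≤1 : ∀ x y → δ x y ≤ 1
  δ≤1 x y with x ≟ y
  ... | yes _ = s≤s z≤n
  ... | no _ = z≤n

  mult : A → List A → ℕ
  mult x xs = sum (map (δ x) xs)

  mult-pos⇒∈ : ∀ x xs → 0 < mult x xs → x ∈ xs
  mult-pos⇒∈ x xs h with sum-pos (δ x) xs h
  ... | y , y∈ , δ>0 rewrite δ-pos x y δ>0 = y∈

  ∈⇒mult-pos : ∀ {x} xs → x ∈ xs → 0 < mult x xs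
  ∈⇒mult-pos {x} (_ ∷ xs) (here refl) rewrite δ-refl x = s≤s z≤n
  ∈⇒mult-pos {x} (y ∷ xs) (there x∈) = ≤-trans (∈⇒mult-pos xs x∈) (m≤n+m (mult x xs) (δ x y))

  ∈-by-mult : ∀ {x} xs ys → mult x xs ≤ mult x ys → x ∈ xs → x ∈ ys
  ∈-by-mult {x} xs ys ≤ys x∈ = mult-pos⇒∈ x ys (≤-trans (∈⇒mult-pos xs x∈) ≤ys)

  mult-absent : ∀ x xs → All (_≢ x) xs → mult x xs ≡ 0
  mult-absent x [] [] = refl
  mult-absent x (y ∷ ys) (y≢x ∷ ys≢x)
    rewrite δ-≢ {x} {y} (λ x≡y → y≢x (sym x≡y)) = mult-absent x ys ys≢x

  mult-replicate : ∀ x m y → mult x (replicate m y) ≡ m * δ x y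
  mult-replicate x zero y = refl
  mult-replicate x (suc m) y = cong (δ x y +_) (mult-replicate x m y)

  mult-picks : ∀ {q} xs → q ∈ picks xs → ∀ y → mult y (proj₂ q) + δ y (proj₁ q) ≡ mult y xs
  mult-picks (x ∷ xs) (here refl) y = +-comm (mult y xs) (δ y x)
  mult-picks (x ∷ xs) (there q∈) y with ∈-map⁻ (λ p → proj₁ p , x ∷ proj₂ p) q∈
  ... | q' , q'∈ , refl = begin
    δ y x + mult y (proj₂ q') + δ y (proj₁ q')   ≡⟨ +-assoc (δ y x) (mult y (proj₂ q')) (δ y (proj₁ q')) ⟩
    δ y x + (mult y (proj₂ q') + δ y (proj₁ q')) ≡⟨ cong (δ y x +_) (mult-picks xs q'∈ y) ⟩
    δ y x + mult y xs                             ∎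
    where open ≡-Reasoning

  mult-remainder : ∀ {q} xs → q ∈ picks xs → ∀ y → mult y (proj₂ q) ≤ mult y xs
  mult-remainder {q} xs q∈ y =
    subst (mult y (proj₂ q) ≤_) (mult-picks xs q∈ y) (m≤m+n (mult y (proj₂ q)) (δ y (proj₁ q)))

  picked-∈ : ∀ {q} xs → q ∈ picks xs → proj₁ q ∈ xs
  picked-∈ {p , others} xs q∈ = mult-pos⇒∈ p xs
    (subst (0 <_) (trans (cong (mult p others +_) (sym (δ-refl p))) (mult-picks xs q∈ p))
           (m≤n+m 1 (mult p others)))

  sum-δ-picks : ∀ y xs → sum (map (λ q → δ y (proj₁ q)) (picks xs)) ≡ mult y xs
  sum-δ-picks y [] = refl
  sum-δ-picks y (x ∷ xs) =
    cong (δ y x +_) (trans (cong sum (sym (map-∘ (picks xs)))) (sum-δ-picks y xs))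

  collisions-bound : ∀ {C : Set} (f g : C → A) qs →
                     (∀ {q q'} → q ∈ qs → q' ∈ qs → f q ≡ f q' → g q ≡ g q') →
                     ∀ y → ∃ λ z → sum (map (λ q → δ y (f q)) qs) ≤ sum (map (λ q → δ z (g q)) qs)
  collisions-bound f g qs determines y with sum (map (λ q → δ y (f q)) qs) in hits
  ... | zero = y , z≤n
  ... | suc _ with sum-pos (λ q → δ y (f q)) qs (subst (0 <_) (sym hits) (s≤s z≤n))
  ...   | q₀ , q₀∈ , δ>0 = g q₀ , subst (_≤ _) hits (sum-mono _ _ qs pointwise)
    where
    pointwise : ∀ q → q ∈ qs → δ y (f q) ≤ δ (g q₀) (g q)
    pointwise q q∈ with y ≟ f q
    ... | no _ = z≤n
    ... | yes y≡fq = subst (1 ≤_) (sym (trans (cong (δ (g q₀)) (sym g-same)) (δ-refl (g q₀)))) ≤-refl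
      where
      g-same : g q₀ ≡ g q
      g-same = determines q₀∈ q∈ (trans (sym (δ-pos y (f q₀) δ>0)) y≡fq)

open Multiplicity _≟ₒ_

exps : Ord → List Ord
exps (cnf xs) = xs

LeanBlock : ℕ → Ord × ℕ → Set
LeanBlock m b = proj₂ b ≤ m × Lean m (proj₁ b)

mutual
  lean-mono : ∀ {m m'} {a} → m ≤ m' → Lean m a → Lean m' a
  lean-mono m≤m' (lean bs) = lean (lean-mono-blocks m≤m' bs)

  lean-mono-blocks : ∀ {m m'} {bs} → m ≤ m' → All (LeanBlock m) bs → All (LeanBlock m') bs
  lean-mono-blocks m≤m' [] = []
  lean-mono-blocks m≤m' ((c≤m , l) ∷ bs) = (≤-trans c≤m m≤m' , lean-mono m≤m' l) ∷ lean-mono-blocks m≤m' bs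

BlockIn : List Ord → Ord × ℕ → Set
BlockIn xs b = proj₁ b ∈ xs × proj₂ b ≤ mult (proj₁ b) xs

blocks-extend : ∀ x xs bs → All (BlockIn xs) bs → All (BlockIn (x ∷ xs)) bs
blocks-extend x xs bs = All.map λ { {z , _} (z∈ , c≤) → there z∈ , ≤-trans c≤ (m≤n+m _ (δ z x)) }

blocks-bounded : ∀ xs → All (BlockIn xs) (group xs)
blocks-bounded [] = []
blocks-bounded (x ∷ xs) with group xs | blocks-bounded xs
... | [] | _ = (here refl , ∈⇒mult-pos (x ∷ xs) (here refl)) ∷ []
... | (y , c) ∷ r | (y∈ , c≤) ∷ r-bounded with compareₒ x y in xy
...   | eq rewrite compare-eq x y xy =
  (there y∈ , subst (suc c ≤_) (cong (_+ mult y xs) (sym (δ-refl y))) (s≤s c≤)) ∷ blocks-extend y xs r r-bounded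
...   | lt = (here refl , ∈⇒mult-pos (x ∷ xs) (here refl)) ∷ blocks-extend x xs ((y , c) ∷ r) ((y∈ , c≤) ∷ r-bounded)
...   | gt = (here refl , ∈⇒mult-pos (x ∷ xs) (here refl)) ∷ blocks-extend x xs ((y , c) ∷ r) ((y∈ , c≤) ∷ r-bounded)

lean-intro : ∀ {m} a → (∀ y → y ∈ exps a → Lean m y) → (∀ y → mult y (exps a) ≤ m) → Lean m a
lean-intro (cnf xs) lean-exps bounded =
  lean (All.map (λ { {y , _} (y∈ , c≤) → ≤-trans c≤ (bounded y) , lean-exps y y∈ }) (blocks-bounded xs))

lean-tail : ∀ {m} x xs → Lean m (cnf (x ∷ xs)) → Lean m (cnf xs)
lean-tail x xs (lean bs) = lean (tail-blocks x xs bs)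
  where
  tail-blocks : ∀ {m} x xs → All (LeanBlock m) (group (x ∷ xs)) → All (LeanBlock m) (group xs)
  tail-blocks x xs bs with group xs
  tail-blocks x xs bs | [] = []
  tail-blocks x xs bs | (y , c) ∷ r with compareₒ x y
  tail-blocks x xs ((1+c≤m , l) ∷ bs) | (y , c) ∷ r | eq = (≤-trans (n≤1+n c) 1+c≤m , l) ∷ bs
  tail-blocks x xs (_ ∷ bs) | (y , c) ∷ r | lt = bs
  tail-blocks x xs (_ ∷ bs) | (y , c) ∷ r | gt = bs

first-block : ∀ x xs → Sorted (x ∷ xs) → ∃ λ r → group (x ∷ xs) ≡ (x , mult x (x ∷ xs)) ∷ r
first-block x [] _ rewrite δ-refl x = [] , refl
first-block x (y ∷ ys) (y≤x ∷ s) with first-block y ys s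
... | r , first rewrite first with compareₒ x y in xy
...   | eq rewrite compare-eq x y xy | δ-refl y = r , refl
...   | lt = ⊥-elim (y≤x (trans (compare-swap x y) (cong reverseCmp xy)))
...   | gt = (y , mult y (y ∷ ys)) ∷ r , cong (λ c → (x , c) ∷ (y , mult y (y ∷ ys)) ∷ r) (sym x-once)
  where
  y<x : y <ₒ x
  y<x = >ₒ⇒<ₒ x y xy
  ys≢x : All (_≢ x) ys
  ys≢x = All.map (λ {w} w≤y → <ₒ⇒≢ w x (≤ₒ-<ₒ-trans w y x w≤y y<x)) (below-head s)
  x-once : mult x (x ∷ y ∷ ys) ≡ 1
  x-once rewrite δ-refl x | mult-absent x (y ∷ ys) (<ₒ⇒≢ y x y<x ∷ ys≢x) = refl

lean-elim : ∀ {m} xs → Sorted xs → Lean m (cnf xs) → (∀ y → y ∈ xs → Lean m y) × (∀ y → mult y xs ≤ m)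
lean-elim [] _ _ = (λ _ ()) , (λ _ → z≤n)
lean-elim {m} (x ∷ xs) s l@(lean bs) with first-block x xs s | lean-elim xs (sorted-tail s) (lean-tail x xs l)
... | r , first | lean-rest , bounded-rest = lean-exps , bounded
  where
  head-block : LeanBlock m (x , mult x (x ∷ xs))
  head-block = All.head (subst (All (LeanBlock m)) first bs)
  lean-exps : ∀ y → y ∈ x ∷ xs → Lean m y
  lean-exps y (here refl) = proj₂ head-block
  lean-exps y (there y∈) = lean-rest y y∈
  bounded : ∀ y → mult y (x ∷ xs) ≤ m
  bounded y with δ-cases y x
  ... | inj₁ refl = proj₁ head-block
  ... | inj₂ δ≡0 = subst (_≤ m) (cong (_+ mult y xs) (sym δ≡0)) (bounded-rest y)

mult-merge : ∀ z xs ys → mult z (merge xs ys) ≡ mult z xs + mult z ys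
mult-merge z [] ys = refl
mult-merge z (x ∷ xs) ys = merge-cons ys
  where
  open ≡-Reasoning
  merge-cons : ∀ ys → mult z (merge (x ∷ xs) ys) ≡ mult z (x ∷ xs) + mult z ys
  merge-cons [] = sym (+-identityʳ _)
  merge-cons (y ∷ ys) with compareₒ x y
  ... | lt = begin
    δ z y + mult z (merge (x ∷ xs) ys)   ≡⟨ cong (δ z y +_) (merge-cons ys) ⟩
    δ z y + (mult z (x ∷ xs) + mult z ys) ≡⟨ +-assoc (δ z y) (mult z (x ∷ xs)) (mult z ys) ⟨
    δ z y + mult z (x ∷ xs) + mult z ys   ≡⟨ cong (_+ mult z ys) (+-comm (δ z y) (mult z (x ∷ xs))) ⟩
    mult z (x ∷ xs) + δ z y + mult z ys   ≡⟨ +-assoc (mult z (x ∷ xs)) (δ z y) (mult z ys) ⟩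
    mult z (x ∷ xs) + mult z (y ∷ ys)     ∎
  ... | eq = trans (cong (δ z x +_) (mult-merge z xs (y ∷ ys))) (sym (+-assoc (δ z x) (mult z xs) _))
  ... | gt = trans (cong (δ z x +_) (mult-merge z xs (y ∷ ys))) (sym (+-assoc (δ z x) (mult z xs) _))

mult-⊕ : ∀ z a b → mult z (exps (a ⊕ b)) ≡ mult z (exps a) + mult z (exps b)
mult-⊕ z (cnf xs) (cnf ys) = mult-merge z xs ys

mult-⨁ω^ : ∀ z xs → mult z (exps (⨁ (map ω^ xs))) ≡ mult z xs
mult-⨁ω^ z [] = refl
mult-⨁ω^ z (x ∷ xs) = begin
  mult z (exps (ω^ x ⊕ ⨁ (map ω^ xs)))        ≡⟨ mult-⊕ z (ω^ x) (⨁ (map ω^ xs)) ⟩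
  δ z x + 0 + mult z (exps (⨁ (map ω^ xs)))   ≡⟨ cong₂ _+_ (+-identityʳ (δ z x)) (mult-⨁ω^ z xs) ⟩
  δ z x + mult z xs                            ∎
  where open ≡-Reasoning

others-mult : ∀ {q} xs → q ∈ picks xs → ∀ y → mult y (exps (⨁ (map ω^ (proj₂ q)))) ≤ mult y xs
others-mult {q} xs q∈ y = ≤-trans (≤-reflexive (mult-⨁ω^ y (proj₂ q))) (mult-remainder xs q∈ y)

others-∈ : ∀ {q y} xs → q ∈ picks xs → y ∈ exps (⨁ (map ω^ (proj₂ q))) → y ∈ xs
others-∈ {q} {y} xs q∈ = ∈-by-mult (exps (⨁ (map ω^ (proj₂ q)))) xs (others-mult xs q∈ y)

lean-⊕ : ∀ {m} a b → (∀ y → y ∈ exps a → Lean m y) → (∀ y → y ∈ exps b → Lean m y) →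
         (∀ y → mult y (exps a) + mult y (exps b) ≤ m) → Lean m (a ⊕ b)
lean-⊕ {m} a b lean-a lean-b bounded = lean-intro (a ⊕ b) lean-exps (λ y → subst (_≤ m) (sym (mult-⊕ y a b)) (bounded y))
  where
  lean-exps : ∀ y → y ∈ exps (a ⊕ b) → Lean m y
  lean-exps y y∈ with +-pos (mult y (exps a)) (mult y (exps b)) (subst (0 <_) (mult-⊕ y a b) (∈⇒mult-pos (exps (a ⊕ b)) y∈))
  ... | inj₁ in-a = lean-a y (mult-pos⇒∈ y (exps a) in-a)
  ... | inj₂ in-b = lean-b y (mult-pos⇒∈ y (exps b) in-b)

mult-dropLast : ∀ z xs → mult z (dropLast xs) ≤ mult z xs
mult-dropLast z [] = z≤n
mult-dropLast z (x ∷ []) = z≤n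
mult-dropLast z (x ∷ y ∷ ys) = +-mono-≤ (≤-refl {δ z x}) (mult-dropLast z (y ∷ ys))

length-dropLast : ∀ x xs → length (dropLast (x ∷ xs)) ≡ length xs
length-dropLast x [] = refl
length-dropLast x (y ∷ ys) = cong suc (length-dropLast y ys)

predₒ-≢ : ∀ x xs → predₒ (cnf (x ∷ xs)) ≢ cnf (x ∷ xs)
predₒ-≢ x xs same =
  1+n≰n (≤-reflexive (trans (cong (λ a → length (exps a)) (sym same)) (length-dropLast x xs)))

pred-lean : ∀ {m} p → IsCNF p → Lean m p → Lean m (predₒ p)
pred-lean (cnf xs) (isCNF sorted _) l with lean-elim xs sorted l
... | lean-exps , bounded =
  lean-intro (cnf (dropLast xs))
    (λ y y∈ → lean-exps y (∈-by-mult (dropLast xs) xs (mult-dropLast y xs) y∈))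
    (λ y → ≤-trans (mult-dropLast y xs) (bounded y))

-- D_n(ω^(ω^p)) = ω^(dExp n p) · (n − 1), where dExp n 0 = 0 and dExp n p = ω^(p − 1) · (n − 1)
dExp : ℕ → Ord → Ord
dExp n (cnf []) = 𝟎
dExp n (cnf (x ∷ xs)) = cnf (replicate (n ∸ 1) (predₒ (cnf (x ∷ xs))))

Dω1-shape : ∀ n p → Dω1 n p ≡ cnf (replicate (n ∸ 1) (dExp n p))
Dω1-shape n (cnf []) = refl
Dω1-shape n (cnf (x ∷ xs)) = refl

mult-dExp : ∀ n z p → mult z (exps (dExp n p)) ≤ n ∸ 1
mult-dExp n z (cnf []) = z≤n
mult-dExp n z (cnf (x ∷ xs)) = begin
  mult z (replicate (n ∸ 1) (predₒ (cnf (x ∷ xs)))) ≡⟨ mult-replicate z (n ∸ 1) _ ⟩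
  (n ∸ 1) * δ z (predₒ (cnf (x ∷ xs)))             ≤⟨ *-monoʳ-≤ (n ∸ 1) (δ≤1 z _) ⟩
  (n ∸ 1) * 1                                      ≡⟨ *-identityʳ (n ∸ 1) ⟩
  n ∸ 1                                            ∎
  where open ≤-Reasoning

-- p itself never occurs in dExp n p, which only involves the predecessor of p
mult-self-dExp : ∀ n p → mult p (exps (dExp n p)) ≡ 0
mult-self-dExp n (cnf []) = refl
mult-self-dExp n (cnf (x ∷ xs)) = begin
  mult p (replicate (n ∸ 1) (predₒ p)) ≡⟨ mult-replicate p (n ∸ 1) (predₒ p) ⟩
  (n ∸ 1) * δ p (predₒ p)              ≡⟨ cong ((n ∸ 1) *_) (δ-≢ (λ p≡pred → predₒ-≢ x xs (sym p≡pred))) ⟩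
  (n ∸ 1) * 0                          ≡⟨ *-zeroʳ (n ∸ 1) ⟩
  0                                    ∎
  where
  open ≡-Reasoning
  p : Ord
  p = cnf (x ∷ xs)

dExp-lean : ∀ {m} n p → IsCNF p → Lean m p → ∀ y → y ∈ exps (dExp n p) → Lean m y
dExp-lean n (cnf (x ∷ xs)) cnf-p lean-p y y∈ rewrite ∈-replicate⁻ (n ∸ 1) y∈ = pred-lean _ cnf-p lean-p

⨂-towers : ∀ ps → ⨂ (map (λ p → ω^ (ω^ p)) ps) ≡ ω^ (⨁ (map ω^ ps))
⨂-towers [] = refl
⨂-towers (p ∷ ps) rewrite ⨂-towers ps = refl

mult-replicate-⊗ : ∀ z m c E → mult z (exps (cnf (replicate m c) ⊗ ω^ E)) ≡ m * δ z (c ⊕ E)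
mult-replicate-⊗ z zero c E = refl
mult-replicate-⊗ z (suc m) c E = begin
  mult z (exps (ω^ (c ⊕ E) ⊕ (cnf (replicate m c) ⊗ ω^ E)))   ≡⟨ mult-⊕ z (ω^ (c ⊕ E)) (cnf (replicate m c) ⊗ ω^ E) ⟩
  δ z (c ⊕ E) + 0 + mult z (exps (cnf (replicate m c) ⊗ ω^ E)) ≡⟨ cong₂ _+_ (+-identityʳ _) (mult-replicate-⊗ z m c E) ⟩
  δ z (c ⊕ E) + m * δ z (c ⊕ E)                                ∎
  where open ≡-Reasoning

term : ℕ → Ord × List Ord → Ord
term n q = Dω1 n (proj₁ q) ⊗ ⨂ (map (λ p → ω^ (ω^ p)) (proj₂ q))

termExp : ℕ → Ord × List Ord → Ord
termExp n q = dExp n (proj₁ q) ⊕ ⨁ (map ω^ (proj₂ q))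

mult-term : ∀ n z q → mult z (exps (term n q)) ≡ (n ∸ 1) * δ z (termExp n q)
mult-term n z (p , others) rewrite ⨂-towers others | Dω1-shape n p =
  mult-replicate-⊗ z (n ∸ 1) (dExp n p) (⨁ (map ω^ others))

mult-Dω : ∀ n z ps → mult z (exps (Dω n (cnf ps))) ≡ (n ∸ 1) * sum (map (λ q → δ z (termExp n q)) (picks ps))
mult-Dω n z ps = trans (mult-⨁-terms (picks ps)) (sum-*ˡ (n ∸ 1) (λ q → δ z (termExp n q)) (picks ps))
  where
  mult-⨁-terms : ∀ qs → mult z (exps (⨁ (map (term n) qs))) ≡ sum (map (λ q → (n ∸ 1) * δ z (termExp n q)) qs)
  mult-⨁-terms [] = refl
  mult-⨁-terms (q ∷ qs) = trans (mult-⊕ z (term n q) _) (cong₂ _+_ (mult-term n z q) (mult-⨁-terms qs))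

-- The exponent of a term determines the picked exponent p: termExp of the pick of p
-- contains one copy of p fewer than termExp of any pick of a different exponent.
termExp-injective : ∀ n ps {q q'} → q ∈ picks ps → q' ∈ picks ps → termExp n q ≡ termExp n q' → proj₁ q ≡ proj₁ q'
termExp-injective n ps {p , o} {p' , o'} q∈ q'∈ same with δ-cases p p'
... | inj₁ p≡p' = p≡p'
... | inj₂ δ≡0 = ⊥-elim (1+n≰n (begin
  suc (mult p o)                          ≡⟨ one-more ⟩
  mult p o'                               ≤⟨ m≤n+m (mult p o') (mult p (exps (dExp n p'))) ⟩
  mult p (exps (dExp n p')) + mult p o'   ≡⟨ mult-termExp p' o' ⟨
  mult p (exps (termExp n (p' , o')))     ≡⟨ cong (λ e → mult p (exps e)) same ⟨
  mult p (exps (termExp n (p , o)))       ≡⟨ mult-termExp p o ⟩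
  mult p (exps (dExp n p)) + mult p o     ≡⟨ cong (_+ mult p o) (mult-self-dExp n p) ⟩
  mult p o                                ∎))
  where
  open ≤-Reasoning
  mult-termExp : ∀ p'' o'' → mult p (exps (termExp n (p'' , o''))) ≡ mult p (exps (dExp n p'')) + mult p o''
  mult-termExp p'' o'' = trans (mult-⊕ p (dExp n p'') _) (cong (mult p (exps (dExp n p'')) +_) (mult-⨁ω^ p o''))
  one-more : suc (mult p o) ≡ mult p o'
  one-more = begin-equality
    suc (mult p o)      ≡⟨ +-comm 1 (mult p o) ⟩
    mult p o + 1        ≡⟨ cong (mult p o +_) (δ-refl p) ⟨
    mult p o + δ p p    ≡⟨ mult-picks ps q∈ p ⟩
    mult p ps           ≡⟨ mult-picks ps q'∈ p ⟨
    mult p o' + δ p p'  ≡⟨ cong (mult p o' +_) δ≡0 ⟩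
    mult p o' + 0       ≡⟨ +-identityʳ (mult p o') ⟩
    mult p o'           ∎

termExp-lean : ∀ {k} n ps {q} → q ∈ picks ps → IsCNF (proj₁ q) → Lean k (proj₁ q) →
               (∀ y → y ∈ ps → Lean k y) → (∀ y → mult y ps ≤ k) → Lean (n ∸ 1 + k) (termExp n q)
termExp-lean {k} n ps {p , o} q∈ cnf-p lean-p lean-ps bounded =
  lean-⊕ (dExp n p) (⨁ (map ω^ o))
    (λ y y∈ → lean-mono (m≤n+m k (n ∸ 1)) (dExp-lean n p cnf-p lean-p y y∈))
    (λ y y∈ → lean-mono (m≤n+m k (n ∸ 1)) (lean-ps y (others-∈ ps q∈ y∈)))
    (λ y → +-mono-≤ (mult-dExp n y p) (≤-trans (others-mult ps q∈ y) (bounded y)))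

Dω-lean-exps : ∀ {k} n ps → All IsCNF ps → (∀ y → y ∈ ps → Lean k y) → (∀ y → mult y ps ≤ k) →
               ∀ y → y ∈ exps (Dω n (cnf ps)) → Lean (n ∸ 1 + k) y
Dω-lean-exps n ps cnf-ps lean-ps bounded y y∈
  with sum-pos (λ q → δ y (termExp n q)) (picks ps)
         (*-pos⁻ʳ (n ∸ 1) _ (subst (0 <_) (mult-Dω n y ps) (∈⇒mult-pos (exps (Dω n (cnf ps))) y∈)))
... | q , q∈ , δ>0 rewrite δ-pos y (termExp n q) δ>0 =
  termExp-lean n ps q∈ (All.lookup cnf-ps (picked-∈ ps q∈)) (lean-ps _ (picked-∈ ps q∈)) lean-ps bounded

Dω-mult-bound : ∀ {k} n ps → (∀ y → mult y ps ≤ k) → ∀ y → mult y (exps (Dω n (cnf ps))) ≤ (n ∸ 1) * k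
Dω-mult-bound n ps bounded y with collisions-bound (termExp n) proj₁ (picks ps) (termExp-injective n ps) y
... | z , hits≤ = subst (_≤ _) (sym (mult-Dω n y ps))
  (*-monoʳ-≤ (n ∸ 1) (≤-trans hits≤ (subst (_≤ _) (sym (sum-δ-picks z ps)) (bounded z))))

derivative-lean : ∀ {k} n .{{_ : NonZero k}} {βs β rest} → Sorted βs → All IsCNF βs → Lean k (cnf βs) →
                  (β , rest) ∈ picks βs → Lean ((n ∸ 1) * k + k) (Dω n β ⊕ ⨁ (map ω^ rest))
derivative-lean {k} n {βs} {cnf ps} {rest} sorted cnf-βs lean-α pick
  with lean-elim βs sorted lean-α | All.lookup cnf-βs (picked-∈ βs pick)
... | lean-βs , bounded-βs | isCNF sorted-ps cnf-ps with lean-elim ps sorted-ps (lean-βs _ (picked-∈ βs pick))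
...   | lean-ps , bounded-ps =
  lean-⊕ (Dω n (cnf ps)) (⨁ (map ω^ rest))
    (λ y y∈ → lean-mono (+-monoˡ-≤ k (m≤m*n (n ∸ 1) k)) (Dω-lean-exps n ps cnf-ps lean-ps bounded-ps y y∈))
    (λ y y∈ → lean-mono (m≤n+m k _) (lean-βs y (others-∈ βs pick y∈)))
    (λ y → +-mono-≤ (Dω-mult-bound n ps bounded-ps y) (≤-trans (others-mult βs pick y) (bounded-βs y)))

bound-≡ : ∀ k n → n > 0 → (n ∸ 1) * k + k ≡ k * n
bound-≡ k (suc n) _ = begin
  n * k + k   ≡⟨ +-comm (n * k) k ⟩
  k + n * k   ≡⟨ cong (k +_) (*-comm n k) ⟩
  k + k * n   ≡⟨ *-suc k n ⟨
  k * suc n   ∎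
  where open ≡-Reasoning

proposition7 : (k n : ℕ) → k > 0 → n > 0 → (α α' : Ord) → IsCNF α → α <ₒ ω^ω^ω → Lean k α → α' ∈ ∂ n α → Lean (k * n) α'
proposition7 k n k>0 n>0 (cnf βs) α' (isCNF sorted cnf-βs) _ lean-α α'∈∂ₙα
  with ∈-map⁻ (λ pick → Dω n (proj₁ pick) ⊕ ⨁ (map ω^ (proj₂ pick))) α'∈∂ₙα
... | (β , rest) , pick , refl =
  subst (λ K → Lean K (Dω n β ⊕ ⨁ (map ω^ rest))) (bound-≡ k n n>0) (derivative-lean n {{>-nonZero k>0}} sorted cnf-βs lean-α pick)
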